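{- Let $A_0, A_1, \ldots, A_m$ be FDDS and $P(X) = \sum_{i=0}^{m} A_i X^i$. If $A_i$ is cancelable for at least one $i \ge 1$, then $P$ is injective, i.e. for all FDDS $X, Y$, $P(X)=P(Y)$ implies $X=Y$.
   Context: An FDDS is a pair $(S,f)$ with $S$ a finite (possibly empty) set and $f:S\to S$, taken up to isomorphism. FDDS form a commutative semiring with sum the disjoint union and product the direct product $(S,f)\times(T,g) = (S\times T, (s,t)\mapsto(f(s),g(t)))$; $X^0$ denotes the one-state FDDS with a fixed point (the multiplicative identity). An FDDS $A$ is cancelable if $AB = AC$ implies $B = C$ for all FDDS $B,C$ (equivalently, at least one connected component of $A$ contains a fixed point). -}

module Defs where

open import Data.Nat using (ℕ; zero; suc; _+_; _*_; _≥_)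
open import Data.Fin using (Fin; toℕ; splitAt; join; combine; remQuot; inject₁; fromℕ)
import Data.Fin as F
open import Data.Sum using (_⊎_; inj₁; inj₂)
open import Data.Product using (Σ; _×_; _,_; ∃)
open import Function.Bundles using (_↔_; Inverse)
open import Relation.Binary.PropositionalEquality using (_≡_)

record FDDS : Set where
  constructor mkFDDS
  field
    size : ℕ
    dyn  : Fin size → Fin size
open FDDS public

-- Isomorphism of FDDS (FDDS are taken up to isomorphism; "=" means ≅).
_≅_ : FDDS → FDDS → Set
A ≅ B = Σ (Fin (size A) ↔ Fin (size B))
          λ φ → ∀ x → Inverse.to φ (dyn A x) ≡ dyn B (Inverse.to φ x)

𝟘 : FDDS
𝟘 = mkFDDS 0 (λ ())

𝟙 : FDDS
𝟙 = mkFDDS 1 (λ x → x)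

_⊕_ : FDDS → FDDS → FDDS
A ⊕ B = mkFDDS (size A + size B) step
  where
  step : Fin (size A + size B) → Fin (size A + size B)
  step i with splitAt (size A) i
  ... | inj₁ a = join (size A) (size B) (inj₁ (dyn A a))
  ... | inj₂ b = join (size A) (size B) (inj₂ (dyn B b))

_⊗_ : FDDS → FDDS → FDDS
A ⊗ B = mkFDDS (size A * size B) step
  where
  step : Fin (size A * size B) → Fin (size A * size B)
  step i with remQuot (size B) i
  ... | a , b = combine (dyn A a) (dyn B b)

_^_ : FDDS → ℕ → FDDS
X ^ zero  = 𝟙
X ^ suc k = X ⊗ (X ^ k)

poly : (m : ℕ) → (Fin (suc m) → FDDS) → FDDS → FDDS
poly zero    A X = A F.zero ⊗ (X ^ 0)
poly (suc m) A X = poly m (λ i → A (inject₁ i)) X ⊕ (A (fromℕ (suc m)) ⊗ (X ^ suc m))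

Cancelable : FDDS → Set
Cancelable A = ∀ B C → (A ⊗ B) ≅ (A ⊗ C) → B ≅ C

-- For a connected FDDS Z the number hom(Z, W) of homomorphisms Z → W turns ⊕ into + and ⊗ into ×,
-- so hom(Z, P(X)) is the value at hom(Z, X) of the polynomial over ℕ with coefficients hom(Z, Aᵢ).
-- When hom(Z, Aₖ) > 0 (k ≥ 1) that polynomial is strictly increasing, so P(X) ≅ P(Y) forces
-- hom(Z, X) = hom(Z, Y); in every case hom(Z, Aₖ X) = hom(Z, Aₖ Y). Splitting a source along an
-- invariant subset multiplies hom counts, so the equality extends to every Z. Lovász's argument then
-- gives Aₖ X ≅ Aₖ Y: sorting homomorphisms by their kernel writes hom(Z, W) as a sum of numbers of
-- injective homomorphisms from quotients of Z, and induction on the size of Z shows that the numbers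
-- of injective homomorphisms into Aₖ X and into Aₖ Y agree; injections both ways are isomorphisms.
-- Cancelling Aₖ gives X ≅ Y.

module Submission where

open import Defs
open import Data.Nat using (ℕ; suc; _≥_)
open import Data.Fin using (Fin; toℕ)
open import Data.Product using (Σ; _×_)

import Algebra.Properties.CommutativeMonoid.Sum as Sum
open import Data.Bool.Base using (Bool; true; false; T; not; _∧_; if_then_else_)
open import Data.Bool.Properties using (T-irrelevant) renaming (_≟_ to _≟ᵇ_)
open import Data.Empty using (⊥)
open import Data.Fin.Base
  using (zero; suc; fromℕ; inject₁; punchIn; punchOut; splitAt; join; _↑ˡ_; _↑ʳ_; combine; remQuot; finToFun; funToFin)
open import Data.Fin.Permutation using (↔⇒≡)
open import Data.Fin.Properties
  using ( _≟_; ¬Fin0; all?; any?; ¬∀⟶∃¬; +↔⊎; *↔×; punchInᵢ≢i; punchOut-injective; injective⇒≤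
        ; cantor-schröder-bernstein; splitAt-↑ˡ; splitAt-↑ʳ; join-splitAt; remQuot-combine; combine-remQuot
        ; funToFin-finToFin; finToFun-funToFin; toℕ-inject₁)
open import Data.Fin.Relation.Unary.Top using (view; ‵fromℕ; ‵inject₁)
open import Data.Fin.Subset using (Subset)
open import Data.Fin.Subset.Properties using (anySubset?)
open import Data.Maybe.Base using (Maybe; just; nothing; fromMaybe)
import Data.Maybe.Base as Maybe
open import Data.Nat.Base using (zero; _+_; _*_; _<_; _≤_; z≤n; s≤s; z<s; >-nonZero)
import Data.Nat.Base as ℕ
open import Data.Nat.Induction using (<-wellFounded)
open import Data.Nat.Properties
  using ( +-0-commutativeMonoid; +-assoc; +-cancelʳ-≡; m≤n⇒m≤1+n; 1+n≰n; ≤-refl; <⇒≤; <⇒≢; <-cmp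
        ; +-mono-≤; +-mono-≤-<; +-mono-<-≤; *-monoʳ-≤; *-monoʳ-<; ^-monoˡ-≤; ^-monoˡ-<)
open import Data.Product.Base using (Σ-syntax; ∃-syntax; _,_; proj₁; proj₂)
import Data.Product.Base as Product
open import Data.Product.Function.NonDependent.Propositional using (_×-cong_)
open import Data.Sum.Base using (_⊎_; inj₁; inj₂; [_,_]′; fromInj₁; fromInj₂)
import Data.Sum.Base as Sum⊎
open import Data.Sum.Function.Propositional using (_⊎-cong_)
open import Data.Unit.Base using (tt)
open import Data.Vec.Base using (lookup; tabulate)
open import Data.Vec.Properties using (lookup∘tabulate)
open import Function.Base using (_∘_; id; const)
open import Function.Bundles using (_↔_; _⇔_; Inverse; Equivalence; mk↔ₛ′; mk⇔)
open import Function.Definitions using (Injective)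
open import Function.Properties.Inverse using (↔-trans; ↔-sym)
open import Induction.WellFounded using (Acc; acc)
open import Relation.Binary.Definitions using (_Respects_; tri<; tri≈; tri>)
open import Relation.Binary.PropositionalEquality
  using (_≡_; _≢_; _≗_; refl; sym; trans; cong; cong₂; subst; module ≡-Reasoning)
open import Relation.Nullary using (¬_; Dec; yes; no; does; ¬?; _×-dec_; contradiction)
open import Relation.Nullary.Decidable using (decidable-stable; does-⇔; dec-false)

open Sum +-0-commutativeMonoid using (sum-syntax; ∑-comm; sum-cong-≗; sum-replicate-zero; sum-remove)
open ≡-Reasoning

private
  variable
    m n z w z′ w′ z″ w″ : ℕ

-- Counting subsets of Fin n

does-sound : ∀ {A : Set} (d : Dec A) → T (does d) → A
does-sound (yes a) _ = a

does-complete : ∀ {A : Set} (d : Dec A) → A → T (does d)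
does-complete (yes _) _ = tt
does-complete (no ¬a) a = ¬a a

count : (Fin n → Bool) → ℕ
count {n} p = ∑[ i < n ] (if p i then 1 else 0)

Subtype : (Fin n → Bool) → Set
Subtype {n} p = Σ[ i ∈ Fin n ] T (p i)

Subtype-≡ : {p : Fin n → Bool} {i j : Fin n} {x : T (p i)} {y : T (p j)} →
            i ≡ j → _≡_ {A = Subtype p} (i , x) (j , y)
Subtype-≡ {x = x} {y} refl = cong (_ ,_) (T-irrelevant x y)

private
  T↔Fin : ∀ b → T b ↔ Fin (if b then 1 else 0)
  T↔Fin true  = mk↔ₛ′ (λ _ → zero) (λ _ → tt) (λ { zero → refl }) (λ _ → refl)
  T↔Fin false = mk↔ₛ′ (λ ()) (λ ()) (λ ()) (λ ())

  Subtype-suc↔ : (p : Fin (suc n) → Bool) → Subtype p ↔ (T (p zero) ⊎ Subtype (p ∘ suc))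
  Subtype-suc↔ p = mk↔ₛ′ to from to-from from-to
    where
    to : Subtype p → T (p zero) ⊎ Subtype (p ∘ suc)
    to (zero  , x) = inj₁ x
    to (suc i , x) = inj₂ (i , x)
    from : T (p zero) ⊎ Subtype (p ∘ suc) → Subtype p
    from (inj₁ x)       = zero , x
    from (inj₂ (i , x)) = suc i , x
    to-from : ∀ y → to (from y) ≡ y
    to-from (inj₁ _) = refl
    to-from (inj₂ _) = refl
    from-to : ∀ y → from (to y) ≡ y
    from-to (zero  , _) = refl
    from-to (suc _ , _) = refl

Subtype↔Fin : (p : Fin n → Bool) → Subtype p ↔ Fin (count p)
Subtype↔Fin {zero}  p = mk↔ₛ′ (λ ()) (λ ()) (λ ()) (λ ())
Subtype↔Fin {suc n} p =
  ↔-trans (Subtype-suc↔ p) (↔-trans (T↔Fin (p zero) ⊎-cong Subtype↔Fin (p ∘ suc)) (↔-sym +↔⊎))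

count-≤ : (p : Fin n → Bool) → count p ≤ n
count-≤ {zero}  p = z≤n
count-≤ {suc n} p with p zero
... | true  = s≤s (count-≤ (p ∘ suc))
... | false = m≤n⇒m≤1+n (count-≤ (p ∘ suc))

count-< : (p : Fin n → Bool) (i : Fin n) → p i ≡ false → count p < n
count-< p zero pᵢ≡false with p zero
count-< p zero () | true
... | false = s≤s (count-≤ (p ∘ suc))
count-< p (suc i) pᵢ≡false with p zero
... | true  = s≤s (count-< (p ∘ suc) i pᵢ≡false)
... | false = m≤n⇒m≤1+n (count-< (p ∘ suc) i pᵢ≡false)

count-≟ : (c : Fin m) → count (λ r → does (c ≟ r)) ≡ 1
count-≟ {suc m} zero    = cong suc (sum-replicate-zero m)
count-≟         (suc c) = count-≟ c

count-partition : (p : Fin n → Bool) (c : Fin n → Fin m) →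
                  count p ≡ ∑[ r < m ] count (λ k → p k ∧ does (c k ≟ r))
count-partition {n} {m} p c = begin
  ∑[ k < n ] (if p k then 1 else 0)                              ≡⟨ sum-cong-≗ one-class ⟩
  ∑[ k < n ] ∑[ r < m ] (if p k ∧ does (c k ≟ r) then 1 else 0)  ≡⟨ ∑-comm {n} {m} _ ⟩
  ∑[ r < m ] count (λ k → p k ∧ does (c k ≟ r))                  ∎
  where
  one-class : ∀ k → (if p k then 1 else 0) ≡ count (λ r → p k ∧ does (c k ≟ r))
  one-class k with p k
  ... | true  = sym (count-≟ (c k))
  ... | false = sym (sum-replicate-zero m)

∑-cancel : (f g : Fin n → ℕ) (r : Fin n) → ∑[ i < n ] f i ≡ ∑[ i < n ] g i →
           (∀ i → i ≢ r → f i ≡ g i) → f r ≡ g r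
∑-cancel {suc n} f g r ∑f≡∑g others = +-cancelʳ-≡ (∑[ i < n ] f (punchIn r i)) (f r) (g r) (begin
  f r + ∑[ i < n ] f (punchIn r i)  ≡⟨ sum-remove f ⟨
  ∑[ i < suc n ] f i                ≡⟨ ∑f≡∑g ⟩
  ∑[ i < suc n ] g i                ≡⟨ sum-remove g ⟩
  g r + ∑[ i < n ] g (punchIn r i)  ≡⟨ cong (g r +_) (sum-cong-≗ (λ i → sym (others _ (punchInᵢ≢i r i)))) ⟩
  g r + ∑[ i < n ] f (punchIn r i)  ∎)

∑-split : ∀ m {n} (f : Fin (m + n) → ℕ) → ∑[ i < m + n ] f i ≡ ∑[ i < m ] f (i ↑ˡ n) + ∑[ j < n ] f (m ↑ʳ j)
∑-split zero    f = refl
∑-split (suc m) f = trans (cong (f zero +_) (∑-split m (f ∘ suc))) (sym (+-assoc (f zero) _ _))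

module Enumeration (p : Fin n → Bool) where

  private
    φ = Subtype↔Fin p

  index : (i : Fin n) → T (p i) → Fin (count p)
  index i x = Inverse.to φ (i , x)

  elem : Fin (count p) → Fin n
  elem q = proj₁ (Inverse.from φ q)

  elem-valid : ∀ q → T (p (elem q))
  elem-valid q = proj₂ (Inverse.from φ q)

  index-cong : ∀ {i j} (x : T (p i)) (y : T (p j)) → i ≡ j → index i x ≡ index j y
  index-cong x y i≡j = cong (Inverse.to φ) (Subtype-≡ i≡j)

  elem-index : ∀ i x → elem (index i x) ≡ i
  elem-index i x = cong proj₁ (Inverse.strictlyInverseʳ φ (i , x))

  index-elem : ∀ q x → index (elem q) x ≡ q
  index-elem q x = trans (index-cong x (elem-valid q) refl) (Inverse.strictlyInverseˡ φ q)

-- Counting sets of functions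

-- Without function extensionality a set of functions is counted through the codes Fin (w ^ z)
-- of its members (finToFun/funToFin); membership must respect ≗ so that it is a property of codes.
record FunPred (z w : ℕ) : Set₁ where
  field
    Holds    : (Fin z → Fin w) → Set
    holds?   : ∀ f → Dec (Holds f)
    respects : Holds Respects _≗_
open FunPred public

codes : FunPred z w → Fin (w ℕ.^ z) → Bool
codes P k = does (holds? P (finToFun k))

-- card, fun and member are opaque so that unification can recover P from card P and f from fun (member f pf).
opaque
  card : FunPred z w → ℕ
  card P = count (codes P)

record Member (P : FunPred z w) : Set where
  constructor member′
  field
    code  : Fin (w ℕ.^ z)
    valid : T (codes P code)

Member↔Subtype : {P : FunPred z w} → Member P ↔ Subtype (codes P)
Member↔Subtype = mk↔ₛ′ (λ x → Member.code x , Member.valid x) (λ (k , v) → member′ k v) (λ _ → refl) (λ _ → refl)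

funToFin-cong : {f g : Fin z → Fin w} → f ≗ g → funToFin f ≡ funToFin g
funToFin-cong {zero}  f≗g = refl
funToFin-cong {suc z} f≗g = cong₂ combine (f≗g zero) (funToFin-cong (f≗g ∘ suc))

opaque

  fun : {P : FunPred z w} → Member P → Fin z → Fin w
  fun (member′ k _) = finToFun k

  fun-holds : {P : FunPred z w} (x : Member P) → Holds P (fun x)
  fun-holds {P = P} (member′ k v) = does-sound (holds? P (finToFun k)) v

  member : {P : FunPred z w} (f : Fin z → Fin w) → Holds P f → Member P
  member {P = P} f pf =
    member′ (funToFin f) (does-complete (holds? P _) (respects P (sym ∘ finToFun-funToFin f) pf))

  fun-member : {P : FunPred z w} (f : Fin z → Fin w) (pf : Holds P f) → fun (member {P = P} f pf) ≗ f
  fun-member f _ = finToFun-funToFin f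

  Member-≡ : {P : FunPred z w} {x y : Member P} → fun x ≗ fun y → x ≡ y
  Member-≡ {z} {w} {x = member′ k _} {member′ l _} x≗y = cong (Inverse.from Member↔Subtype) (Subtype-≡ (begin
    k                              ≡⟨ funToFin-finToFin {z} {w} k ⟨
    funToFin (finToFun {w} {z} k)  ≡⟨ funToFin-cong x≗y ⟩
    funToFin (finToFun {w} {z} l)  ≡⟨ funToFin-finToFin {z} {w} l ⟩
    l                              ∎))

opaque
  unfolding card

  Member↔Fin : (P : FunPred z w) → Member P ↔ Fin (card P)
  Member↔Fin P = ↔-trans Member↔Subtype (Subtype↔Fin (codes P))

card-↔ : {P : FunPred z w} {Q : FunPred z′ w′} → Member P ↔ Member Q → card P ≡ card Q
card-↔ {P = P} {Q} φ = ↔⇒≡ (↔-trans (↔-sym (Member↔Fin P)) (↔-trans φ (Member↔Fin Q)))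

card-↔× : {P : FunPred z w} {Q : FunPred z′ w′} {R : FunPred z″ w″} →
          Member P ↔ (Member Q × Member R) → card P ≡ card Q * card R
card-↔× {P = P} {Q} {R} φ = ↔⇒≡ (↔-trans (↔-sym (Member↔Fin P))
  (↔-trans φ (↔-trans (Member↔Fin Q ×-cong Member↔Fin R) (↔-sym *↔×))))

card-≡1 : {P : FunPred z w} (x : Member P) → (∀ y → fun y ≗ fun x) → card P ≡ 1
card-≡1 {P = P} x unique = ↔⇒≡ (↔-trans (↔-sym (Member↔Fin P))
  (mk↔ₛ′ (λ _ → zero) (λ _ → x) (λ { zero → refl }) (λ y → sym (Member-≡ (unique y)))))

card-empty : (P : FunPred z w) → ¬ Member P → card P ≡ 0
card-empty P ¬x with card P | Member↔Fin P
... | zero  | _ = refl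
... | suc _ | φ = contradiction (Inverse.from φ zero) ¬x

Member? : (P : FunPred z w) → Dec (Member P)
Member? P with card P | Member↔Fin P
... | zero  | φ = no (λ x → ¬Fin0 (Inverse.to φ x))
... | suc _ | φ = yes (Inverse.from φ zero)

Member-transport : (P : FunPred z w) (Q : FunPred z′ w′) → card P ≡ card Q → Member P → Member Q
Member-transport P Q e = Inverse.from (Member↔Fin Q) ∘ subst Fin e ∘ Inverse.to (Member↔Fin P)

_∩_ : FunPred z w → FunPred z w → FunPred z w
P ∩ Q = record
  { Holds    = λ f → Holds P f × Holds Q f
  ; holds?   = λ f → holds? P f ×-dec holds? Q f
  ; respects = λ f≗g → Product.map (respects P f≗g) (respects Q f≗g)
  }

Fiber : (c : (Fin z → Fin w) → Fin m) → (∀ {f g} → f ≗ g → c f ≡ c g) → Fin m → FunPred z w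
Fiber c c-cong r = record
  { Holds    = λ f → c f ≡ r
  ; holds?   = λ f → c f ≟ r
  ; respects = λ f≗g cf≡r → trans (sym (c-cong f≗g)) cf≡r
  }

opaque
  unfolding card

  card-partition : (P : FunPred z w) (c : (Fin z → Fin w) → Fin m) (c-cong : ∀ {f g} → f ≗ g → c f ≡ c g) →
                   card P ≡ ∑[ r < m ] card (P ∩ Fiber c c-cong r)
  card-partition P c _ = count-partition (codes P) (c ∘ finToFun)

-- Homomorphism counts

IsHom : (Z W : FDDS) → (Fin (size Z) → Fin (size W)) → Set
IsHom Z W h = ∀ i → h (dyn Z i) ≡ dyn W (h i)

Hom : (Z W : FDDS) → FunPred (size Z) (size W)
Hom Z W = record
  { Holds    = IsHom Z W
  ; holds?   = λ h → all? (λ i → h (dyn Z i) ≟ dyn W (h i))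
  ; respects = λ h≗g h-hom i → trans (sym (h≗g _)) (trans (h-hom i) (cong (dyn W) (h≗g i)))
  }

hom : FDDS → FDDS → ℕ
hom Z W = card (Hom Z W)

IsHom-∘ : ∀ {Z Y W g h} → IsHom Y W g → IsHom Z Y h → IsHom Z W (g ∘ h)
IsHom-∘ {g = g} g-hom h-hom i = trans (cong g (h-hom i)) (g-hom _)

postcompose : ∀ {Z W W′} g → IsHom W W′ g → Member (Hom Z W) → Member (Hom Z W′)
postcompose {Z} {W} {W′} g g-hom h = member (g ∘ fun h) (IsHom-∘ {Z} {W} {W′} {g} {fun h} g-hom (fun-holds h))

precompose : ∀ {Z′ Z W} g → IsHom Z′ Z g → Member (Hom Z W) → Member (Hom Z′ W)
precompose {Z′} {Z} {W} g g-hom h = member (fun h ∘ g) (IsHom-∘ {Z′} {Z} {W} {fun h} {g} (fun-holds h) g-hom)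

hom-cong : ∀ Z {W W′} → W ≅ W′ → hom Z W ≡ hom Z W′
hom-cong Z {W} {W′} (φ , φ-hom) = card-↔ (mk↔ₛ′ (postcompose to φ-hom) (postcompose from φ⁻¹-hom)
  (λ h → Member-≡ λ i → trans (fun-member _ _ i) (trans (cong to (fun-member _ _ i)) (strictlyInverseˡ (fun h i))))
  (λ h → Member-≡ λ i → trans (fun-member _ _ i) (trans (cong from (fun-member _ _ i)) (strictlyInverseʳ (fun h i)))))
  where
  open Inverse φ
  φ⁻¹-hom : IsHom W′ W from
  φ⁻¹-hom y = begin
    from (dyn W′ y)             ≡⟨ cong (from ∘ dyn W′) (strictlyInverseˡ y) ⟨
    from (dyn W′ (to (from y))) ≡⟨ cong from (φ-hom (from y)) ⟨
    from (to (dyn W (from y)))  ≡⟨ strictlyInverseʳ _ ⟩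
    dyn W (from y)              ∎

module ⊗-Projections (A B : FDDS) where

  π₁ : Fin (size (A ⊗ B)) → Fin (size A)
  π₁ i = proj₁ (remQuot {size A} (size B) i)

  π₂ : Fin (size (A ⊗ B)) → Fin (size B)
  π₂ i = proj₂ (remQuot {size A} (size B) i)

  dyn-⊗ : ∀ i → dyn (A ⊗ B) i ≡ combine (dyn A (π₁ i)) (dyn B (π₂ i))
  dyn-⊗ i with remQuot {size A} (size B) i
  ... | _ = refl

  dyn-combine : ∀ a b → dyn (A ⊗ B) (combine a b) ≡ combine (dyn A a) (dyn B b)
  dyn-combine a b = trans (dyn-⊗ _) (cong (λ (a , b) → combine (dyn A a) (dyn B b)) (remQuot-combine a b))

  π₁-combine : ∀ a b → π₁ (combine {size A} {size B} a b) ≡ a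
  π₁-combine a b = cong proj₁ (remQuot-combine a b)

  π₂-combine : ∀ a b → π₂ (combine {size A} {size B} a b) ≡ b
  π₂-combine a b = cong proj₂ (remQuot-combine a b)

  π₁-hom : IsHom (A ⊗ B) A π₁
  π₁-hom i = trans (cong π₁ (dyn-⊗ i)) (π₁-combine _ _)

  π₂-hom : IsHom (A ⊗ B) B π₂
  π₂-hom i = trans (cong π₂ (dyn-⊗ i)) (π₂-combine _ _)

  pair-hom : ∀ {Z f g} → IsHom Z A f → IsHom Z B g → IsHom Z (A ⊗ B) (λ i → combine (f i) (g i))
  pair-hom {f = f} {g} f-hom g-hom i = trans (cong₂ combine (f-hom i) (g-hom i)) (sym (dyn-combine (f i) (g i)))

hom-⊗ : ∀ Z A B → hom Z (A ⊗ B) ≡ hom Z A * hom Z B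
hom-⊗ Z A B = card-↔× (mk↔ₛ′ split pair split-pair pair-split)
  where
  open ⊗-Projections A B
  split : Member (Hom Z (A ⊗ B)) → Member (Hom Z A) × Member (Hom Z B)
  split h = postcompose π₁ π₁-hom h , postcompose π₂ π₂-hom h
  pair : Member (Hom Z A) × Member (Hom Z B) → Member (Hom Z (A ⊗ B))
  pair (f , g) = member (λ i → combine (fun f i) (fun g i)) (pair-hom (fun-holds f) (fun-holds g))
  split-pair : ∀ fg → split (pair fg) ≡ fg
  split-pair (f , g) = cong₂ _,_
    (Member-≡ λ i → trans (fun-member _ _ i) (trans (cong π₁ (fun-member _ _ i)) (π₁-combine (fun f i) (fun g i))))
    (Member-≡ λ i → trans (fun-member _ _ i) (trans (cong π₂ (fun-member _ _ i)) (π₂-combine (fun f i) (fun g i))))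
  pair-split : ∀ h → pair (split h) ≡ h
  pair-split h = Member-≡ λ i → trans (fun-member _ _ i)
    (trans (cong₂ (combine {size A} {size B}) (fun-member _ _ i) (fun-member _ _ i))
           (combine-remQuot {size A} (size B) _))

hom-𝟙 : ∀ Z → hom Z 𝟙 ≡ 1
hom-𝟙 Z = card-≡1 (member (λ _ → zero) (λ _ → refl)) (λ h i → trans (Fin1-unique (fun h i)) (sym (Fin1-unique _)))
  where
  Fin1-unique : (x : Fin 1) → x ≡ zero
  Fin1-unique zero = refl

hom-from-empty : ∀ d W → hom (mkFDDS 0 d) W ≡ 1
hom-from-empty d W = card-≡1 (member (λ ()) (λ ())) (λ _ ())

hom-^ : ∀ Z X n → hom Z (X ^ n) ≡ hom Z X ℕ.^ n
hom-^ Z X zero    = hom-𝟙 Z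
hom-^ Z X (suc n) = trans (hom-⊗ Z X (X ^ n)) (cong (hom Z X *_) (hom-^ Z X n))

-- Connected sources: hom(Z, −) is additive

Invariant : (Z : FDDS) → (Fin (size Z) → Bool) → Set
Invariant Z S = ∀ i → S (dyn Z i) ≡ S i

record Connected (Z : FDDS) : Set where
  field
    point              : Fin (size Z)
    invariant-constant : ∀ S → Invariant Z S → ∀ i → S i ≡ S point

module ⊕-Injections (A B : FDDS) where

  private
    a = size A
    b = size B

    isInj₁ : Fin a ⊎ Fin b → Bool
    isInj₁ = [ const true , const false ]′

  dyn-⊕ : ∀ y → splitAt a (dyn (A ⊕ B) y) ≡ Sum⊎.map (dyn A) (dyn B) (splitAt a y)
  dyn-⊕ y with splitAt a y
  ... | inj₁ x = splitAt-↑ˡ a (dyn A x) b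
  ... | inj₂ x = splitAt-↑ʳ a b (dyn B x)

  ↑ˡ-hom : IsHom A (A ⊕ B) (_↑ˡ b)
  ↑ˡ-hom x rewrite splitAt-↑ˡ a x b = refl

  ↑ʳ-hom : IsHom B (A ⊕ B) (a ↑ʳ_)
  ↑ʳ-hom x rewrite splitAt-↑ʳ a b x = refl

  isLeft : Fin (a + b) → Bool
  isLeft = isInj₁ ∘ splitAt a

  isLeft-invariant : Invariant (A ⊕ B) isLeft
  isLeft-invariant y rewrite dyn-⊕ y with splitAt a y
  ... | inj₁ _ = refl
  ... | inj₂ _ = refl

  isRight-invariant : Invariant (A ⊕ B) (not ∘ isLeft)
  isRight-invariant = cong not ∘ isLeft-invariant

  isLeft-↑ˡ : ∀ x → isLeft (x ↑ˡ b) ≡ true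
  isLeft-↑ˡ x = cong isInj₁ (splitAt-↑ˡ a x b)

  isRight-↑ʳ : ∀ y → not (isLeft (a ↑ʳ y)) ≡ true
  isRight-↑ʳ y = cong (not ∘ isInj₁) (splitAt-↑ʳ a b y)

  fromLeft : Fin a → Fin (a + b) → Fin a
  fromLeft d = fromInj₁ (const d) ∘ splitAt a

  fromRight : Fin b → Fin (a + b) → Fin b
  fromRight d = fromInj₂ (const d) ∘ splitAt a

  fromLeft-↑ˡ : ∀ d x → fromLeft d (x ↑ˡ b) ≡ x
  fromLeft-↑ˡ d x = cong (fromInj₁ (const d)) (splitAt-↑ˡ a x b)

  fromRight-↑ʳ : ∀ d y → fromRight d (a ↑ʳ y) ≡ y
  fromRight-↑ʳ d y = cong (fromInj₂ (const d)) (splitAt-↑ʳ a b y)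

  ↑ˡ-fromLeft : ∀ d y → isLeft y ≡ true → fromLeft d y ↑ˡ b ≡ y
  ↑ˡ-fromLeft d y isLeft-y = trans (cong (join a b) (on-left (splitAt a y) isLeft-y)) (join-splitAt a b y)
    where
    on-left : ∀ s → isInj₁ s ≡ true → inj₁ (fromInj₁ (const d) s) ≡ s
    on-left (inj₁ _) _ = refl

  ↑ʳ-fromRight : ∀ d y → not (isLeft y) ≡ true → a ↑ʳ fromRight d y ≡ y
  ↑ʳ-fromRight d y isRight-y = trans (cong (join a b) (on-right (splitAt a y) isRight-y)) (join-splitAt a b y)
    where
    on-right : ∀ s → not (isInj₁ s) ≡ true → inj₂ (fromInj₂ (const d) s) ≡ s
    on-right (inj₂ _) _ = refl

module _ {Z : FDDS} (Z-connected : Connected Z) where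
  open Connected Z-connected

  Pointed : (W : FDDS) → Fin (size W) → FunPred (size Z) (size W)
  Pointed W = Hom Z W ∩_ ∘ Fiber (λ h → h point) (λ h≗g → h≗g point)

  hom-pointed : ∀ W → hom Z W ≡ ∑[ y < size W ] card (Pointed W y)
  hom-pointed W = card-partition (Hom Z W) (λ h → h point) (λ h≗g → h≗g point)

  -- C sits inside W as the invariant part S through ι, with retraction π d (d is a junk value off S).
  -- A connected Z whose base point lands in S lands entirely in S.
  module _ {W C : FDDS} (ι : Fin (size C) → Fin (size W)) (ι-hom : IsHom C W ι)
           (S : Fin (size W) → Bool) (S-invariant : Invariant W S) (S-ι : ∀ x → S (ι x) ≡ true)
           (π : Fin (size C) → Fin (size W) → Fin (size C)) (π-ι : ∀ d x → π d (ι x) ≡ x)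
           (ι-π : ∀ d y → S y ≡ true → ι (π d y) ≡ y) where

    card-Pointed-retract : ∀ x → card (Pointed W (ι x)) ≡ card (Pointed C x)
    card-Pointed-retract x = card-↔ (mk↔ₛ′ restrict extend
      (λ g → Member-≡ λ i → trans (fun-member _ _ i) (trans (cong (π x) (fun-member _ _ i)) (π-ι x (fun g i))))
      (λ h → Member-≡ λ i → trans (fun-member _ _ i) (trans (cong ι (fun-member _ _ i)) (ι-π x (fun h i) (in-S h i)))))
      where
      in-S : (h : Member (Pointed W (ι x))) → ∀ i → S (fun h i) ≡ true
      in-S h i = begin
        S (fun h i)     ≡⟨ invariant-constant (S ∘ fun h) S∘h-invariant i ⟩
        S (fun h point) ≡⟨ cong S (proj₂ (fun-holds h)) ⟩
        S (ι x)         ≡⟨ S-ι x ⟩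
        true            ∎
        where
        S∘h-invariant : Invariant Z (S ∘ fun h)
        S∘h-invariant j = trans (cong S (proj₁ (fun-holds h) j)) (S-invariant _)
      restrict : Member (Pointed W (ι x)) → Member (Pointed C x)
      restrict h = member (π x ∘ fun h) (π-hom , trans (cong (π x) (proj₂ (fun-holds h))) (π-ι x x))
        where
        π-hom : IsHom Z C (π x ∘ fun h)
        π-hom i = begin
          π x (fun h (dyn Z i))            ≡⟨ cong (π x) (proj₁ (fun-holds h) i) ⟩
          π x (dyn W (fun h i))            ≡⟨ cong (π x ∘ dyn W) (ι-π x _ (in-S h i)) ⟨
          π x (dyn W (ι (π x (fun h i))))  ≡⟨ cong (π x) (ι-hom _) ⟨
          π x (ι (dyn C (π x (fun h i))))  ≡⟨ π-ι x _ ⟩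
          dyn C (π x (fun h i))            ∎
      extend : Member (Pointed C x) → Member (Pointed W (ι x))
      extend g = member (ι ∘ fun g) (IsHom-∘ {Z} {C} {W} ι-hom (proj₁ (fun-holds g)) , cong ι (proj₂ (fun-holds g)))

  hom-⊕ : ∀ A B → hom Z (A ⊕ B) ≡ hom Z A + hom Z B
  hom-⊕ A B = begin
    hom Z (A ⊕ B)                                                  ≡⟨ hom-pointed (A ⊕ B) ⟩
    ∑[ y < a + b ] card (Pointed (A ⊕ B) y)                        ≡⟨ ∑-split a _ ⟩
    ∑[ x < a ] card (Pointed (A ⊕ B) (x ↑ˡ b))
      + ∑[ y < b ] card (Pointed (A ⊕ B) (a ↑ʳ y))                ≡⟨ cong₂ _+_ (sum-cong-≗ left) (sum-cong-≗ right) ⟩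
    ∑[ x < a ] card (Pointed A x) + ∑[ y < b ] card (Pointed B y)  ≡⟨ cong₂ _+_ (hom-pointed A) (hom-pointed B) ⟨
    hom Z A + hom Z B                                              ∎
    where
    open ⊕-Injections A B
    a = size A
    b = size B
    left : ∀ x → card (Pointed (A ⊕ B) (x ↑ˡ b)) ≡ card (Pointed A x)
    left = card-Pointed-retract (_↑ˡ b) ↑ˡ-hom isLeft isLeft-invariant isLeft-↑ˡ fromLeft fromLeft-↑ˡ ↑ˡ-fromLeft
    right : ∀ y → card (Pointed (A ⊕ B) (a ↑ʳ y)) ≡ card (Pointed B y)
    right = card-Pointed-retract (a ↑ʳ_) ↑ʳ-hom (not ∘ isLeft) isRight-invariant isRight-↑ʳ
                                 fromRight fromRight-↑ʳ ↑ʳ-fromRight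

-- Polynomials over ℕ

eval : (m : ℕ) → (Fin (suc m) → ℕ) → ℕ → ℕ
eval zero    a x = a zero * x ℕ.^ 0
eval (suc m) a x = eval m (a ∘ inject₁) x + a (fromℕ (suc m)) * x ℕ.^ suc m

eval-mono : ∀ m a {x y} → x ≤ y → eval m a x ≤ eval m a y
eval-mono zero    a x≤y = ≤-refl
eval-mono (suc m) a x≤y =
  +-mono-≤ (eval-mono m (a ∘ inject₁) x≤y) (*-monoʳ-≤ (a (fromℕ (suc m))) (^-monoˡ-≤ (suc m) x≤y))

eval-strictMono : ∀ m a (k : Fin (suc m)) → toℕ k ≥ 1 → 0 < a k →
                  ∀ {x y} → x < y → eval m a x < eval m a y
eval-strictMono zero    a zero () _ _
eval-strictMono (suc m) a k k≥1 aₖ>0 x<y with view k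
... | ‵fromℕ     = +-mono-≤-< (eval-mono m (a ∘ inject₁) (<⇒≤ x<y))
                              (*-monoʳ-< _ {{>-nonZero aₖ>0}} (^-monoˡ-< (suc m) x<y))
... | ‵inject₁ j = +-mono-<-≤ (eval-strictMono m (a ∘ inject₁) j (subst (_≥ 1) (toℕ-inject₁ j) k≥1) aₖ>0 x<y)
                              (*-monoʳ-≤ (a (fromℕ (suc m))) (^-monoˡ-≤ (suc m) (<⇒≤ x<y)))

eval-injective : ∀ m a (k : Fin (suc m)) → toℕ k ≥ 1 → 0 < a k →
                 ∀ {x y} → eval m a x ≡ eval m a y → x ≡ y
eval-injective m a k k≥1 aₖ>0 {x} {y} e with <-cmp x y
... | tri< x<y _ _ = contradiction e (<⇒≢ (eval-strictMono m a k k≥1 aₖ>0 x<y))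
... | tri≈ _ x≡y _ = x≡y
... | tri> _ _ y<x = contradiction (sym e) (<⇒≢ (eval-strictMono m a k k≥1 aₖ>0 y<x))

*-congˡ-nonZero : ∀ a {x y} → (0 < a → x ≡ y) → a * x ≡ a * y
*-congˡ-nonZero zero    _   = refl
*-congˡ-nonZero (suc a) x≡y = cong (suc a *_) (x≡y z<s)

hom-monomial : ∀ Z B X n → hom Z (B ⊗ (X ^ n)) ≡ hom Z B * hom Z X ℕ.^ n
hom-monomial Z B X n = trans (hom-⊗ Z B (X ^ n)) (cong (hom Z B *_) (hom-^ Z X n))

hom-poly : ∀ {Z} → Connected Z → ∀ m A X → hom Z (poly m A X) ≡ eval m (hom Z ∘ A) (hom Z X)
hom-poly {Z} Z-connected zero    A X = hom-monomial Z (A zero) X 0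
hom-poly {Z} Z-connected (suc m) A X = trans (hom-⊕ Z-connected _ _)
  (cong₂ _+_ (hom-poly Z-connected m (A ∘ inject₁) X) (hom-monomial Z (A (fromℕ (suc m))) X (suc m)))

poly-≅⇒hom-coefficient-⊗-≡ : ∀ m A (k : Fin (suc m)) → toℕ k ≥ 1 → ∀ X Y → poly m A X ≅ poly m A Y →
                             ∀ Z → Connected Z → hom Z (A k ⊗ X) ≡ hom Z (A k ⊗ Y)
poly-≅⇒hom-coefficient-⊗-≡ m A k k≥1 X Y PX≅PY Z Z-connected = begin
  hom Z (A k ⊗ X)        ≡⟨ hom-⊗ Z (A k) X ⟩
  hom Z (A k) * hom Z X  ≡⟨ *-congˡ-nonZero (hom Z (A k)) hom-X≡hom-Y ⟩
  hom Z (A k) * hom Z Y  ≡⟨ hom-⊗ Z (A k) Y ⟨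
  hom Z (A k ⊗ Y)        ∎
  where
  eval-≡ : eval m (hom Z ∘ A) (hom Z X) ≡ eval m (hom Z ∘ A) (hom Z Y)
  eval-≡ = trans (sym (hom-poly Z-connected m A X)) (trans (hom-cong Z PX≅PY) (hom-poly Z-connected m A Y))
  hom-X≡hom-Y : 0 < hom Z (A k) → hom Z X ≡ hom Z Y
  hom-X≡hom-Y aₖ>0 = eval-injective m (hom Z ∘ A) k k≥1 aₖ>0 eval-≡

-- Splitting a source along an invariant subset

private
  T-or-T-not : ∀ b → T b ⊎ T (not b)
  T-or-T-not true  = inj₁ tt
  T-or-T-not false = inj₂ tt

  T-and-T-not : ∀ {b} → T b → T (not b) → ⊥
  T-and-T-not {true} _ ()

module Restriction (Z : FDDS) (S : Fin (size Z) → Bool) (S-invariant : Invariant Z S) where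
  open Enumeration S public

  Sub : FDDS
  Sub = mkFDDS (count S) (λ q → index (dyn Z (elem q)) (subst T (sym (S-invariant (elem q))) (elem-valid q)))

  elem-hom : IsHom Sub Z elem
  elem-hom q = elem-index _ _

  index-hom : ∀ {W g} → IsHom Sub W g → ∀ i x y → g (index (dyn Z i) y) ≡ dyn W (g (index i x))
  index-hom {g = g} g-hom i x y = trans (cong g (index-cong _ _ (cong (dyn Z) (sym (elem-index i x))))) (g-hom _)

module _ (Z : FDDS) (S : Fin (size Z) → Bool) (S-invariant : Invariant Z S) where
  private
    module In  = Restriction Z S S-invariant
    module Out = Restriction Z (not ∘ S) (cong not ∘ S-invariant)

  hom-split : ∀ W → hom Z W ≡ hom In.Sub W * hom Out.Sub W
  hom-split W = card-↔× (mk↔ₛ′ split merge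
    (λ (g₁ , g₂) → cong₂ _,_
       (Member-≡ λ q → trans (fun-member _ _ q) (trans (fun-member _ _ _) (glue-in (fun g₁) (fun g₂) q)))
       (Member-≡ λ q → trans (fun-member _ _ q) (trans (fun-member _ _ _) (glue-out (fun g₁) (fun g₂) q))))
    (λ h → Member-≡ λ i → trans (fun-member _ _ i) (glue-elem (fun h) (fun-member _ _) (fun-member _ _) i)))
    where
    glue : ∀ {X : Set} → (Fin (size In.Sub) → X) → (Fin (size Out.Sub) → X) → Fin (size Z) → X
    glue g₁ g₂ i = [ g₁ ∘ In.index i , g₂ ∘ Out.index i ]′ (T-or-T-not (S i))

    glue-in : ∀ {X : Set} (g₁ : Fin (size In.Sub) → X) g₂ q → glue g₁ g₂ (In.elem q) ≡ g₁ q
    glue-in g₁ g₂ q with T-or-T-not (S (In.elem q))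
    ... | inj₁ x = cong g₁ (In.index-elem q x)
    ... | inj₂ y = contradiction y (T-and-T-not (In.elem-valid q))

    glue-out : ∀ {X : Set} g₁ (g₂ : Fin (size Out.Sub) → X) q → glue g₁ g₂ (Out.elem q) ≡ g₂ q
    glue-out g₁ g₂ q with T-or-T-not (S (Out.elem q))
    ... | inj₁ x = contradiction (Out.elem-valid q) (T-and-T-not x)
    ... | inj₂ y = cong g₂ (Out.index-elem q y)

    glue-elem : ∀ {X : Set} {g₁ g₂} (f : Fin (size Z) → X) →
                g₁ ≗ f ∘ In.elem → g₂ ≗ f ∘ Out.elem → glue g₁ g₂ ≗ f
    glue-elem f g₁≗f g₂≗f i with T-or-T-not (S i)
    ... | inj₁ x = trans (g₁≗f _) (cong f (In.elem-index i x))
    ... | inj₂ y = trans (g₂≗f _) (cong f (Out.elem-index i y))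

    glue-hom : ∀ {g₁ g₂} → IsHom In.Sub W g₁ → IsHom Out.Sub W g₂ → IsHom Z W (glue g₁ g₂)
    glue-hom g₁-hom g₂-hom i with T-or-T-not (S i) | T-or-T-not (S (dyn Z i))
    ... | inj₁ x | inj₁ x′ = In.index-hom {W} g₁-hom i x x′
    ... | inj₂ y | inj₂ y′ = Out.index-hom {W} g₂-hom i y y′
    ... | inj₁ x | inj₂ y′ = contradiction y′ (T-and-T-not (subst T (sym (S-invariant i)) x))
    ... | inj₂ y | inj₁ x′ = contradiction (subst T (cong not (sym (S-invariant i))) y) (T-and-T-not x′)

    split : Member (Hom Z W) → Member (Hom In.Sub W) × Member (Hom Out.Sub W)
    split h = precompose In.elem In.elem-hom h , precompose Out.elem Out.elem-hom h

    merge : Member (Hom In.Sub W) × Member (Hom Out.Sub W) → Member (Hom Z W)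
    merge (g₁ , g₂) = member (glue (fun g₁) (fun g₂)) (glue-hom (fun-holds g₁) (fun-holds g₂))

record Splitting (Z : FDDS) : Set where
  field
    part         : Fin (size Z) → Bool
    invariant    : Invariant Z part
    outside      : Fin (size Z)
    inside       : Fin (size Z)
    part-outside : part outside ≡ false
    part-inside  : part inside ≡ true

splitting : ∀ {Z} S → Invariant Z S → ∀ {i j} → S i ≢ S j → Splitting Z
splitting S S-invariant {i} {j} Sᵢ≢Sⱼ with S i in Sᵢ | S j in Sⱼ
... | false | true  = record
  { part = S ; invariant = S-invariant ; outside = i ; inside = j ; part-outside = Sᵢ ; part-inside = Sⱼ }
... | true  | false = record
  { part = S ; invariant = S-invariant ; outside = j ; inside = i ; part-outside = Sⱼ ; part-inside = Sᵢ }
... | false | false = contradiction refl Sᵢ≢Sⱼ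
... | true  | true  = contradiction refl Sᵢ≢Sⱼ

Separates : (Z : FDDS) → Fin (size Z) → Subset (size Z) → Set
Separates Z pt S = Invariant Z (lookup S) × ∃[ i ] lookup S i ≢ lookup S pt

separates? : ∀ Z pt S → Dec (Separates Z pt S)
separates? Z pt S = all? (λ i → lookup S (dyn Z i) ≟ᵇ lookup S i) ×-dec any? (λ i → ¬? (lookup S i ≟ᵇ lookup S pt))

connected-or-splitting : ∀ Z → Fin (size Z) → Connected Z ⊎ Splitting Z
connected-or-splitting Z pt with anySubset? (separates? Z pt)
... | yes (S , S-invariant , i , Sᵢ≢Sₚₜ) = inj₂ (splitting (lookup S) S-invariant Sᵢ≢Sₚₜ)
... | no ¬split = inj₁ (record { point = pt ; invariant-constant = constant })
  where
  constant : ∀ S → Invariant Z S → ∀ i → S i ≡ S pt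
  constant S S-invariant i = decidable-stable (S i ≟ᵇ S pt) λ Sᵢ≢Sₚₜ → ¬split (tabulate S ,
    (λ j → trans (lookup∘tabulate S (dyn Z j)) (trans (S-invariant j) (sym (lookup∘tabulate S j)))) ,
    i , λ e → Sᵢ≢Sₚₜ (trans (sym (lookup∘tabulate S i)) (trans e (lookup∘tabulate S pt))))

hom-≡-from-connected : ∀ U V → (∀ Z → Connected Z → hom Z U ≡ hom Z V) → ∀ Z → hom Z U ≡ hom Z V
hom-≡-from-connected U V agree Z = go Z (<-wellFounded (size Z))
  where
  go : ∀ Z → Acc _<_ (size Z) → hom Z U ≡ hom Z V
  go (mkFDDS zero d) _ = trans (hom-from-empty d U) (sym (hom-from-empty d V))
  go Z@(mkFDDS (suc n) d) (acc smaller) with connected-or-splitting Z zero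
  ... | inj₁ Z-connected = agree Z Z-connected
  ... | inj₂ s = begin
    hom Z U                      ≡⟨ hom-split Z part invariant U ⟩
    hom In.Sub U * hom Out.Sub U ≡⟨ cong₂ _*_ (go In.Sub (smaller In-smaller)) (go Out.Sub (smaller Out-smaller)) ⟩
    hom In.Sub V * hom Out.Sub V ≡⟨ hom-split Z part invariant V ⟨
    hom Z V                      ∎
    where
    open Splitting s
    module In  = Restriction Z part invariant
    module Out = Restriction Z (not ∘ part) (cong not ∘ invariant)
    In-smaller : size In.Sub < size Z
    In-smaller = count-< part outside part-outside
    Out-smaller : size Out.Sub < size Z
    Out-smaller = count-< (not ∘ part) inside (cong not part-inside)

-- Kernels and quotients

first : (Fin n → Bool) → Maybe (Fin n)
first {zero}  p = nothing
first {suc n} p = if p zero then just zero else Maybe.map suc (first (p ∘ suc))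

first-cong : {p q : Fin n → Bool} → p ≗ q → first p ≡ first q
first-cong {zero}  p≗q = refl
first-cong {suc n} p≗q =
  cong₂ (λ b m → if b then just zero else m) (p≗q zero) (cong (Maybe.map suc) (first-cong (p≗q ∘ suc)))

first-found : (p : Fin n → Bool) (i : Fin n) → T (p i) → ∃[ j ] (first p ≡ just j × T (p j))
first-found {suc n} p i pᵢ with p zero in p₀
... | true = zero , refl , subst T (sym p₀) tt
first-found p zero    pᵢ | false = contradiction (subst T p₀ pᵢ) λ ()
first-found p (suc i) pᵢ | false with first-found (p ∘ suc) i pᵢ
... | j , first≡j , pⱼ = suc j , cong (Maybe.map suc) first≡j , pⱼ

SameKernel : (Fin z → Fin w) → (Fin z → Fin w′) → Set
SameKernel h g = ∀ i j → (h i ≡ h j) ⇔ (g i ≡ g j)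

≗⇒SameKernel : {h g : Fin z → Fin w} → h ≗ g → SameKernel h g
≗⇒SameKernel h≗g i j =
  mk⇔ (λ e → trans (sym (h≗g i)) (trans e (h≗g j))) (λ e → trans (h≗g i) (trans e (sym (h≗g j))))

SameKernel-sym : {f : Fin z → Fin w} {g : Fin z → Fin w′} → SameKernel f g → SameKernel g f
SameKernel-sym f~g i j = mk⇔ (Equivalence.from (f~g i j)) (Equivalence.to (f~g i j))

SameKernel-trans : {f : Fin z → Fin w} {g : Fin z → Fin w′} {h : Fin z → Fin w″} →
                   SameKernel f g → SameKernel g h → SameKernel f h
SameKernel-trans f~g g~h i j = mk⇔ (to (g~h i j) ∘ to (f~g i j)) (from (f~g i j) ∘ from (g~h i j))
  where open Equivalence

SameKernel-∘ : {f : Fin z → Fin w} {g : Fin w → Fin w′} → Injective _≡_ _≡_ g → SameKernel (g ∘ f) f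
SameKernel-∘ {g = g} g-injective i j = mk⇔ g-injective (cong g)

-- The kernel of h, represented by the endomap sending i to the least j with h j ≡ h i.
kernelRep : (Fin z → Fin w) → Fin z → Fin z
kernelRep h i = fromMaybe i (first (λ j → does (h j ≟ h i)))

private
  first-class : (h : Fin z → Fin w) (i : Fin z) → ∃[ j ] (first (λ k → does (h k ≟ h i)) ≡ just j × h j ≡ h i)
  first-class h i with first-found (λ k → does (h k ≟ h i)) i (does-complete (h i ≟ h i) refl)
  ... | j , first≡j , hⱼ = j , first≡j , does-sound (h j ≟ h i) hⱼ

kernelRep-spec : (h : Fin z → Fin w) (i : Fin z) → h (kernelRep h i) ≡ h i
kernelRep-spec h i with first-class h i
... | j , first≡j , hⱼ≡hᵢ rewrite first≡j = hⱼ≡hᵢ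

kernelRep-resp : (h : Fin z → Fin w) {i j : Fin z} → h i ≡ h j → kernelRep h i ≡ kernelRep h j
kernelRep-resp h {i} {j} hᵢ≡hⱼ with first-class h i
... | k , first≡k , _ =
  trans (cong (fromMaybe i) first≡k) (sym (cong (fromMaybe j) (trans (sym (first-cong same-class)) first≡k)))
  where
  same-class : (λ l → does (h l ≟ h i)) ≗ (λ l → does (h l ≟ h j))
  same-class l = cong (λ y → does (h l ≟ y)) hᵢ≡hⱼ

kernelRep-cong : {h : Fin z → Fin w} {g : Fin z → Fin w′} → SameKernel h g → kernelRep h ≗ kernelRep g
kernelRep-cong {h = h} {g} same i =
  cong (fromMaybe i) (first-cong (λ j → does-⇔ (same j i) (h j ≟ h i) (g j ≟ g i)))

SameKernel-kernelRep : (h : Fin z → Fin w) → SameKernel (kernelRep h) h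
SameKernel-kernelRep h i j = mk⇔
  (λ e → trans (sym (kernelRep-spec h i)) (trans (cong h e) (kernelRep-spec h j)))
  (kernelRep-resp h)

kernelRep≗id⇒injective : (h : Fin z → Fin w) → kernelRep h ≗ id → Injective _≡_ _≡_ h
kernelRep≗id⇒injective h kernelRep≗id {i} {j} hᵢ≡hⱼ =
  trans (sym (kernelRep≗id i)) (trans (kernelRep-resp h hᵢ≡hⱼ) (kernelRep≗id j))

injective⇒kernelRep≗id : (h : Fin z → Fin w) → Injective _≡_ _≡_ h → kernelRep h ≗ id
injective⇒kernelRep≗id h h-injective i = h-injective (kernelRep-spec h i)

-- ρ sends every state to the least element of its class for a congruence of Z.
record IsCongruenceRep (Z : FDDS) (ρ : Fin (size Z) → Fin (size Z)) : Set where
  field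
    canonical  : kernelRep ρ ≗ ρ
    compatible : ∀ {i j} → ρ i ≡ ρ j → ρ (dyn Z i) ≡ ρ (dyn Z j)

IsCongruenceRep-cong : ∀ {Z ρ σ} → ρ ≗ σ → IsCongruenceRep Z ρ → IsCongruenceRep Z σ
IsCongruenceRep-cong {Z} ρ≗σ c = record
  { canonical  = λ i → trans (sym (kernelRep-cong ρ~σ i)) (trans (canonical i) (ρ≗σ i))
  ; compatible = λ {i} {j} → to (ρ~σ (dyn Z i) (dyn Z j)) ∘ compatible ∘ from (ρ~σ i j)
  }
  where
  open IsCongruenceRep c
  open Equivalence
  ρ~σ = ≗⇒SameKernel ρ≗σ

kernelRep-isCongruenceRep : ∀ {Z W h} → IsHom Z W h → IsCongruenceRep Z (kernelRep h)
kernelRep-isCongruenceRep {Z} {W} {h} h-hom = record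
  { canonical  = kernelRep-cong (SameKernel-kernelRep h)
  ; compatible = λ {i} {j} e → kernelRep-resp h (begin
      h (dyn Z i) ≡⟨ h-hom i ⟩
      dyn W (h i) ≡⟨ cong (dyn W) (Equivalence.to (SameKernel-kernelRep h i j) e) ⟩
      dyn W (h j) ≡⟨ h-hom j ⟨
      h (dyn Z j) ∎)
  }

kernelCode : (Fin z → Fin w) → Fin (z ℕ.^ z)
kernelCode {z} h = funToFin {z} (kernelRep h)

KernelClass : (Z W : FDDS) → Fin (size Z ℕ.^ size Z) → FunPred (size Z) (size W)
KernelClass Z W = Hom Z W ∩_ ∘ Fiber kernelCode (funToFin-cong ∘ kernelRep-cong ∘ ≗⇒SameKernel)

identityCode : ∀ z → Fin (z ℕ.^ z)
identityCode z = funToFin {z} id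

InjHom : (Z W : FDDS) → FunPred (size Z) (size W)
InjHom Z W = KernelClass Z W (identityCode (size Z))

inj : FDDS → FDDS → ℕ
inj Z W = card (InjHom Z W)

hom-by-kernel : ∀ Z W → hom Z W ≡ ∑[ r < size Z ℕ.^ size Z ] card (KernelClass Z W r)
hom-by-kernel Z W = card-partition (Hom Z W) kernelCode _

module _ {Z W : FDDS} {r : Fin (size Z ℕ.^ size Z)} where

  kernelRep-KernelClass : (h : Member (KernelClass Z W r)) → kernelRep (fun h) ≗ finToFun r
  kernelRep-KernelClass h i =
    trans (sym (finToFun-funToFin (kernelRep (fun h)) i)) (cong (λ k → finToFun k i) (proj₂ (fun-holds h)))

  KernelClass-isCongruenceRep : Member (KernelClass Z W r) → IsCongruenceRep Z (finToFun r)
  KernelClass-isCongruenceRep h =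
    IsCongruenceRep-cong (kernelRep-KernelClass h) (kernelRep-isCongruenceRep {Z} {W} {fun h} (proj₁ (fun-holds h)))

  kernelCode-≡ : ∀ {h : Fin (size Z) → Fin (size W)} → kernelRep h ≗ finToFun r → kernelCode h ≡ r
  kernelCode-≡ e = trans (funToFin-cong e) (funToFin-finToFin {size Z} {size Z} r)

InjHom-injective : ∀ {Z W} (h : Member (InjHom Z W)) → Injective _≡_ _≡_ (fun h)
InjHom-injective h = kernelRep≗id⇒injective (fun h) (λ i → trans (kernelRep-KernelClass h i) (finToFun-funToFin id i))

injective⇒InjHom : ∀ {Z W} h → IsHom Z W h → Injective _≡_ _≡_ h → Member (InjHom Z W)
injective⇒InjHom h h-hom h-injective = member h (h-hom , funToFin-cong (injective⇒kernelRep≗id h h-injective))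

-- The states of Z/ρ are the fixed points of ρ, one for each class.
module Quotient (Z : FDDS) (r : Fin (size Z ℕ.^ size Z)) (ρ-congruence : IsCongruenceRep Z (finToFun r)) where

  ρ : Fin (size Z) → Fin (size Z)
  ρ = finToFun r

  open IsCongruenceRep ρ-congruence
  open Enumeration (λ i → does (ρ i ≟ i))

  ρ-idempotent : ∀ i → ρ (ρ i) ≡ ρ i
  ρ-idempotent i = trans (cong ρ (sym (canonical i))) (kernelRep-spec ρ i)

  class : Fin (size Z) → Fin (count (λ i → does (ρ i ≟ i)))
  class i = index (ρ i) (does-complete (ρ (ρ i) ≟ ρ i) (ρ-idempotent i))

  elem-class : ∀ i → elem (class i) ≡ ρ i
  elem-class i = elem-index _ _

  ρ-elem : ∀ q → ρ (elem q) ≡ elem q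
  ρ-elem q = does-sound (ρ (elem q) ≟ elem q) (elem-valid q)

  class-elem : ∀ q → class (elem q) ≡ q
  class-elem q = trans (index-cong _ (elem-valid q) (ρ-elem q)) (index-elem q _)

  Z/ρ : FDDS
  Z/ρ = mkFDDS (count (λ i → does (ρ i ≟ i))) (λ q → class (dyn Z (elem q)))

  class-hom : IsHom Z Z/ρ class
  class-hom i = index-cong _ _ (compatible (begin
    ρ i                ≡⟨ ρ-idempotent i ⟨
    ρ (ρ i)            ≡⟨ cong ρ (elem-class i) ⟨
    ρ (elem (class i)) ∎))

  SameKernel-class : SameKernel class ρ
  SameKernel-class i j = mk⇔
    (λ e → trans (sym (elem-class i)) (trans (cong elem e) (elem-class j)))
    (index-cong _ _)

  Z/ρ-smaller : r ≢ identityCode (size Z) → size Z/ρ < size Z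
  Z/ρ-smaller r≢id with ¬∀⟶∃¬ (size Z) (λ i → ρ i ≡ i) (λ i → ρ i ≟ i) ρ≢id
    where
    ρ≢id : ¬ (∀ i → ρ i ≡ i)
    ρ≢id ρ≗id = r≢id (trans (sym (funToFin-finToFin {size Z} {size Z} r)) (funToFin-cong ρ≗id))
  ... | i , ρᵢ≢i = count-< _ i (dec-false (ρ i ≟ i) ρᵢ≢i)

  card-KernelClass : ∀ W → card (KernelClass Z W r) ≡ inj Z/ρ W
  card-KernelClass W = card-↔ (mk↔ₛ′ restrict lift
    (λ g → Member-≡ λ q → trans (fun-member _ _ q) (trans (fun-member _ _ _) (cong (fun g) (class-elem q))))
    (λ h → Member-≡ λ i → trans (fun-member _ _ i)
                            (trans (fun-member _ _ _) (trans (cong (fun h) (elem-class i)) (h∘ρ≗h h i)))))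
    where
    SameKernel-ρ : (h : Member (KernelClass Z W r)) → SameKernel (fun h) ρ
    SameKernel-ρ h =
      SameKernel-trans (SameKernel-sym (SameKernel-kernelRep (fun h))) (≗⇒SameKernel (kernelRep-KernelClass h))

    h∘ρ≗h : (h : Member (KernelClass Z W r)) → ∀ i → fun h (ρ i) ≡ fun h i
    h∘ρ≗h h i = Equivalence.from (SameKernel-ρ h (ρ i) i) (ρ-idempotent i)

    restrict : Member (KernelClass Z W r) → Member (InjHom Z/ρ W)
    restrict h = injective⇒InjHom (fun h ∘ elem) restrict-hom restrict-injective
      where
      restrict-hom : IsHom Z/ρ W (fun h ∘ elem)
      restrict-hom q = trans (cong (fun h) (elem-class _)) (trans (h∘ρ≗h h _) (proj₁ (fun-holds h) (elem q)))
      restrict-injective : Injective _≡_ _≡_ (fun h ∘ elem)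
      restrict-injective {a} {b} e = trans (sym (class-elem a)) (trans (cong class elem-≡) (class-elem b))
        where
        elem-≡ : elem a ≡ elem b
        elem-≡ = trans (sym (ρ-elem a)) (trans (Equivalence.to (SameKernel-ρ h _ _) e) (ρ-elem b))

    lift : Member (InjHom Z/ρ W) → Member (KernelClass Z W r)
    lift g = member (fun g ∘ class)
      (IsHom-∘ {Z} {Z/ρ} {W} (proj₁ (fun-holds g)) class-hom , kernelCode-≡ {Z} {W} {r} {fun g ∘ class} kernelRep≗ρ)
      where
      same-kernel : SameKernel (fun g ∘ class) ρ
      same-kernel = SameKernel-trans (SameKernel-∘ {f = class} (InjHom-injective g)) SameKernel-class
      kernelRep≗ρ : kernelRep (fun g ∘ class) ≗ ρ
      kernelRep≗ρ i = trans (kernelRep-cong {h = fun g ∘ class} same-kernel i) (canonical i)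

inj-≡ : ∀ U V → (∀ Z → hom Z U ≡ hom Z V) → ∀ Z → inj Z U ≡ inj Z V
inj-≡ U V agree Z = go Z (<-wellFounded (size Z))
  where
  go : ∀ Z → Acc _<_ (size Z) → inj Z U ≡ inj Z V
  go Z (acc smaller) = ∑-cancel (card ∘ KernelClass Z U) (card ∘ KernelClass Z V) (identityCode (size Z))
    (trans (sym (hom-by-kernel Z U)) (trans (agree Z) (hom-by-kernel Z V))) other-classes
    where
    via-quotient : ∀ r → r ≢ identityCode (size Z) → IsCongruenceRep Z (finToFun r) →
                   card (KernelClass Z U r) ≡ card (KernelClass Z V r)
    via-quotient r r≢id ρ-congruence = begin
      card (KernelClass Z U r) ≡⟨ card-KernelClass U ⟩
      inj Z/ρ U                ≡⟨ go Z/ρ (smaller (Z/ρ-smaller r≢id)) ⟩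
      inj Z/ρ V                ≡⟨ card-KernelClass V ⟨
      card (KernelClass Z V r) ∎
      where open Quotient Z r ρ-congruence

    other-classes : ∀ r → r ≢ identityCode (size Z) → card (KernelClass Z U r) ≡ card (KernelClass Z V r)
    other-classes r r≢id with Member? (KernelClass Z U r) | Member? (KernelClass Z V r)
    ... | yes h | _     = via-quotient r r≢id (KernelClass-isCongruenceRep h)
    ... | no _  | yes h = via-quotient r r≢id (KernelClass-isCongruenceRep h)
    ... | no ¬u | no ¬v = trans (card-empty _ ¬u) (sym (card-empty _ ¬v))

injective⇒surjective : {f : Fin m → Fin n} → Injective _≡_ _≡_ f → m ≡ n → ∀ y → ∃[ x ] f x ≡ y
injective⇒surjective {suc n} {f = f} f-injective refl y with any? (λ x → f x ≟ y)
... | yes found = found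
... | no ∄x = contradiction (injective⇒≤ punched-injective) 1+n≰n
  where
  punched : Fin (suc n) → Fin n
  punched x = punchOut {i = y} {j = f x} (λ y≡fx → ∄x (x , sym y≡fx))
  punched-injective : Injective _≡_ _≡_ punched
  punched-injective e = f-injective (punchOut-injective {i = y} _ _ e)

hom-≡⇒≅ : ∀ U V → (∀ Z → hom Z U ≡ hom Z V) → U ≅ V
hom-≡⇒≅ U V agree = mk↔ₛ′ (fun h) (proj₁ ∘ onto) (proj₂ ∘ onto) from-to , proj₁ (fun-holds h)
  where
  injection : ∀ X Y → (∀ Z → inj Z X ≡ inj Z Y) → Member (InjHom X Y)
  injection X Y inj≡ = Member-transport _ _ (inj≡ X) (injective⇒InjHom id (λ _ → refl) id)
  h = injection U V (inj-≡ U V agree)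
  g = injection V U (λ Z → sym (inj-≡ U V agree Z))
  onto = injective⇒surjective (InjHom-injective h) (cantor-schröder-bernstein (InjHom-injective h) (InjHom-injective g))
  from-to : ∀ x → proj₁ (onto (fun h x)) ≡ x
  from-to x = InjHom-injective h (proj₂ (onto (fun h x)))

proposition3 : (m : ℕ) (A : Fin (suc m) → FDDS)
    → Σ (Fin (suc m)) (λ i → (toℕ i ≥ 1) × Cancelable (A i))
    → ∀ X Y → poly m A X ≅ poly m A Y → X ≅ Y
proposition3 m A (k , k≥1 , Aₖ-cancelable) X Y PX≅PY =
  Aₖ-cancelable X Y (hom-≡⇒≅ (A k ⊗ X) (A k ⊗ Y)
    (hom-≡-from-connected (A k ⊗ X) (A k ⊗ Y) (poly-≅⇒hom-coefficient-⊗-≡ m A k k≥1 X Y PX≅PY)))
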